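{- Let $G$ be a graph, $k$ a positive integer and $e\in E(G)$. Then $\gamma_{all,k}^\infty(G-e)\geq \gamma_{all,k}^\infty(G)$.
   Context: Graphs are finite and simple; $d(u,v)$ is graph distance and $N_k[x]=\{v: d(x,v)\le k\}$. A multiset $D$ of vertices of $G$ is a distance-$k$ dominating set if every vertex of $V(G)\setminus D$ is at distance at most $k$ from some element of $D$. Let $\mathbb{D}_{k,q}(G)$ be the set of such multisets of cardinality $q$. $D=\{v_1,\dots,v_q\}$ transforms to $D'=\{u_1,\dots,u_q\}$ if (for some indexing) $u_i\in N_k[v_i]$ for all $i$. An eternal distance-$k$ dominating family is $\mathcal{E}\subseteq\mathbb{D}_{k,q}(G)$ for some $q$ such that for every $D\in\mathcal{E}$ and every vertex $v$ there is $D'\in\mathcal{E}$ with $v\in D'$ and $D$ transforms to $D'$. $\gamma_{all,k}^\infty(G)$ is the minimum $q$ for which such a family exists. -}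

module Defs where

open import Level using (0ℓ)
open import Data.Nat using (ℕ; zero; suc; _≤_)
open import Data.Fin using (Fin)
open import Data.Fin.Permutation using (Permutation; _⟨$⟩ʳ_)
open import Data.Vec using (Vec; lookup)
open import Data.Vec.Membership.Propositional using (_∈_; _∉_)
open import Data.Product using (Σ; ∃; _×_; _,_)
open import Data.Sum using (_⊎_; inj₁; inj₂)
open import Relation.Nullary using (¬_)
open import Relation.Binary.PropositionalEquality using (_≡_)

record Graph (n : ℕ) : Set₁ where
  field
    Adj    : Fin n → Fin n → Set
    sym    : ∀ {u v} → Adj u v → Adj v u
    irrefl : ∀ {u} → ¬ Adj u u
open Graph public

SamePair : ∀ {n} → Fin n → Fin n → Fin n → Fin n → Set
SamePair x y a b = (x ≡ a × y ≡ b) ⊎ (x ≡ b × y ≡ a)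

private
  swapPair : ∀ {n} {x y a b : Fin n} → SamePair x y a b → SamePair y x a b
  swapPair (inj₁ (p , q)) = inj₂ (q , p)
  swapPair (inj₂ (p , q)) = inj₁ (q , p)

deleteEdge : ∀ {n} (G : Graph n) (a b : Fin n) → Adj G a b → Graph n
deleteEdge G a b _ = record
  { Adj    = λ x y → Adj G x y × ¬ SamePair x y a b
  ; sym    = λ { (h , ns) → Graph.sym G h , λ s → ns (swapPair s) }
  ; irrefl = λ { (h , _) → Graph.irrefl G h }
  }

data Within {n} (G : Graph n) : ℕ → Fin n → Fin n → Set where
  here : ∀ {k u} → Within G k u u
  step : ∀ {k u w v} → Adj G u w → Within G k w v → Within G (suc k) u v

-- multisets of size q are represented by vectors (Vec (Fin n) q), up to reordering
IsDistDom : ∀ {n q} (G : Graph n) (k : ℕ) → Vec (Fin n) q → Set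
IsDistDom G k D = ∀ v → v ∉ D → ∃ λ i → Within G k (lookup D i) v

Transforms : ∀ {n q} (G : Graph n) (k : ℕ) → Vec (Fin n) q → Vec (Fin n) q → Set
Transforms {q = q} G k D D' =
  Σ (Permutation q q) λ σ → ∀ i → Within G k (lookup D i) (lookup D' (σ ⟨$⟩ʳ i))

IsEternalFamily : ∀ {n} (G : Graph n) (k q : ℕ) → (Vec (Fin n) q → Set) → Set
IsEternalFamily G k q ℰ =
  (∃ λ D → ℰ D)
  × (∀ D → ℰ D → IsDistDom G k D)
  × (∀ D → ℰ D → ∀ v → ∃ λ D' → ℰ D' × v ∈ D' × Transforms G k D D')

HasEternalFamily : ∀ {n} (G : Graph n) (k q : ℕ) → Set₁
HasEternalFamily {n} G k q = Σ (Vec (Fin n) q → Set) (IsEternalFamily G k q)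

IsEternalDomNumber : ∀ {n} (G : Graph n) (k q : ℕ) → Set₁
IsEternalDomNumber G k q =
  HasEternalFamily G k q × (∀ q' → HasEternalFamily G k q' → q ≤ q')

{-# OPTIONS --safe #-}
module Submission where

-- Adding an edge only shortens distances, so every eternal distance-k dominating
-- family of G - e is also one of G, and the minimum for G can only be smaller.

open import Defs
open import Data.Nat using (ℕ; _≤_)
open import Data.Fin using (Fin)
open import Data.Vec using (Vec)
open import Data.Product using (_,_)

_⊆ᴳ_ : ∀ {n} → Graph n → Graph n → Set
H ⊆ᴳ G = ∀ {u v} → Adj H u v → Adj G u v

deleteEdge-⊆ᴳ : ∀ {n} (G : Graph n) (a b : Fin n) (e : Adj G a b) → deleteEdge G a b e ⊆ᴳ G
deleteEdge-⊆ᴳ G a b e (h , _) = h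

module _ {n} {H G : Graph n} (H⊆G : H ⊆ᴳ G) where

  Within-mono : ∀ {k u v} → Within H k u v → Within G k u v
  Within-mono here       = here
  Within-mono (step h w) = step (H⊆G h) (Within-mono w)

  IsDistDom-mono : ∀ {q k} {D : Vec (Fin n) q} → IsDistDom H k D → IsDistDom G k D
  IsDistDom-mono dom v v∉D with dom v v∉D
  ... | i , w = i , Within-mono w

  Transforms-mono : ∀ {q k} (D D′ : Vec (Fin n) q) → Transforms H k D D′ → Transforms G k D D′
  Transforms-mono D D′ (σ , moves) = σ , λ i → Within-mono (moves i)

  IsEternalFamily-mono : ∀ {k q ℰ} → IsEternalFamily H k q ℰ → IsEternalFamily G k q ℰ
  IsEternalFamily-mono (nonempty , dominating , defends) =
      nonempty
    , (λ D D∈ℰ → IsDistDom-mono (dominating D D∈ℰ))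
    , λ D D∈ℰ v → let (D′ , D′∈ℰ , v∈D′ , D→D′) = defends D D∈ℰ v
                  in D′ , D′∈ℰ , v∈D′ , Transforms-mono D D′ D→D′

  HasEternalFamily-mono : ∀ {k q} → HasEternalFamily H k q → HasEternalFamily G k q
  HasEternalFamily-mono (ℰ , isFamily) = ℰ , IsEternalFamily-mono isFamily

  IsEternalDomNumber-mono : ∀ {k γG γH} →
    IsEternalDomNumber G k γG → IsEternalDomNumber H k γH → γG ≤ γH
  IsEternalDomNumber-mono (_ , minimalG) (familyH , _) = minimalG _ (HasEternalFamily-mono familyH)

lemma2 : ∀ {n} (G : Graph n) (k : ℕ) → 1 ≤ k → (a b : Fin n) (e : Adj G a b) →
    ∀ γG γGe → IsEternalDomNumber G k γG → IsEternalDomNumber (deleteEdge G a b e) k γGe →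
    γG ≤ γGe
-- The argument works for every k.
lemma2 G k _ a b e γG γGe = IsEternalDomNumber-mono (deleteEdge-⊆ᴳ G a b e)
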